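{- Let $(U,\mathcal{D},G^*)$ be a standard configuration, let $D,E\in\mathcal{D}$, let $(S,B)$ be a primitive pair for $\Lambda^*(D)$, and let $C$ be a block of $\Lambda^*(E)$ such that not all $S'\in B[\Lambda^*(D)\cdot S]$ have the same weaving type with respect to $C$ (i.e. the $C$-canonical partition of $B[\Lambda^*(D)\cdot S]$ has more than one nonempty set). Then for any $\Phi,\Psi\in G^*$ with $\Phi^{\Lambda^*(E)\cdot C}=\Psi^{\Lambda^*(E)\cdot C}$ and $\Phi^{\Lambda^*(D)\cdot B}=\Psi^{\Lambda^*(D)\cdot B}$ we have $\Phi^{\Lambda^*(D)\cdot S}=\Psi^{\Lambda^*(D)\cdot S}$.
   Context: A standard configuration $(U,\mathcal{D},G^*)$: $U$ is a finite ordered set containing no nontrivial order-autonomous antichain (a nonempty $A\subseteq U$ is order-autonomous iff for every $z\notin A$, $z<a$ for some $a\in A$ implies $z<A$, and $z>a$ for some $a\in A$ implies $z>A$; nontrivial means $|A|\notin\{1,|U|\}$), $G^*$ is a subgroup of ${\rm Aut}(U)$, $\mathcal{D}$ is the set of $G^*$-orbits. For $D\in\mathcal{D}$, $\Lambda^*(D)=\{\Phi|_D:\Phi\in G^*\}$; a block of $\Lambda^*(D)$ is $B\subseteq D$ with $\sigma[B]=B$ or $\sigma[B]\cap B=\emptyset$ for all $\sigma\in\Lambda^*(D)$; $\Lambda^*(D)\cdot B=\{\Phi[B]:\Phi\in G^*\}$, and $\Phi^{\Lambda^*(D)\cdot B}$ is the permutation $X\mapsto\Phi[X]$ of $\Lambda^*(D)\cdot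 B$. For blocks $S\subsetneq B$ of $\Lambda^*(D)$, $B[\Lambda^*(D)\cdot S]=\{S'\in\Lambda^*(D)\cdot S:S'\subseteq B\}$, and $(S,B)$ is a primitive pair iff the group $\{\Phi^{\Lambda^*(D)\cdot S}|_{B[\Lambda^*(D)\cdot S]}:\Phi\in G^*,\Phi[B]\subseteq B\}$ is primitive on $B[\Lambda^*(D)\cdot S]$ (transitive, no blocks other than singletons and the whole set). Weaving type of a pair $(X,Y)$ with $X\in\Lambda^*(E)\cdot C$, $Y\in\Lambda^*(D)\cdot S$: "made" if $X<Y$ or $X>Y$ (elementwise strictly); "incomparable" if no element of $X$ is comparable to an element of $Y$; otherwise nontrivially woven, with type equal to its class $\{(\Phi[X],\Phi[Y]):\Phi\in G^*\}$. The elements $S'$ have the same weaving type with respect to $C$ iff the pairs $(C,S')$ have the same type. -}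

module Defs where

open import Level using (0ℓ)
open import Data.Nat.Base using (ℕ)
open import Data.Fin.Base using (Fin)
open import Data.Fin.Subset using (Subset; _∈_; _∉_; _⊆_; _⊂_; _∩_; ∣_∣; Nonempty; Empty)
open import Data.Fin.Permutation using (Permutation′; _⟨$⟩ʳ_; _⟨$⟩ˡ_; id; flip; _∘ₚ_; _≈_)
open import Data.Vec.Base using (tabulate; lookup)
open import Data.Product.Base using (Σ; ∃; _×_; _,_)
open import Data.Sum.Base using (_⊎_)
open import Relation.Nullary using (¬_)
open import Relation.Unary using (Pred)
open import Relation.Binary.Core using (Rel)
open import Relation.Binary.Structures using (IsStrictPartialOrder)
open import Relation.Binary.PropositionalEquality using (_≡_; _≢_)

-- Everything relative to a finite ordered set U = Fin n with strict order _<_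
-- and a set G of permutations of U (intended: the group G*).
module Config {n : ℕ} (_<_ : Rel (Fin n) 0ℓ) (G : Pred (Permutation′ n) 0ℓ) where

  IsAntichain : Subset n → Set
  IsAntichain A = ∀ {a b} → a ∈ A → b ∈ A → ¬ (a < b)

  IsOrderAutonomous : Subset n → Set
  IsOrderAutonomous A =
    Nonempty A ×
    (∀ z → z ∉ A →
       ((∃ λ a → a ∈ A × z < a) → ∀ {a} → a ∈ A → z < a) ×
       ((∃ λ a → a ∈ A × a < z) → ∀ {a} → a ∈ A → a < z))

  IsNontrivial : Subset n → Set
  IsNontrivial A = ∣ A ∣ ≢ 1 × ∣ A ∣ ≢ n

  NoNontrivialAutonomousAntichain : Set
  NoNontrivialAutonomousAntichain =
    ∀ A → IsOrderAutonomous A → IsAntichain A → ¬ IsNontrivial A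

  IsAutomorphism : Permutation′ n → Set
  IsAutomorphism Φ = ∀ x y → (x < y → (Φ ⟨$⟩ʳ x) < (Φ ⟨$⟩ʳ y))
                           × ((Φ ⟨$⟩ʳ x) < (Φ ⟨$⟩ʳ y) → x < y)

  record IsSubgroupOfAut : Set where
    field
      ⊆Aut    : ∀ {Φ} → G Φ → IsAutomorphism Φ
      id∈     : G id
      ∘∈      : ∀ {Φ Ψ} → G Φ → G Ψ → G (Φ ∘ₚ Ψ)
      inv∈    : ∀ {Φ} → G Φ → G (flip Φ)
      resp-≈  : ∀ {Φ Ψ} → Φ ≈ Ψ → G Φ → G Ψ

  record IsStandardConfiguration : Set where
    field
      isSPO      : IsStrictPartialOrder _≡_ _<_
      noAutAnti  : NoNontrivialAutonomousAntichain
      isSubgroup : IsSubgroupOfAut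

  infix 20 _[_]
  _[_] : Permutation′ n → Subset n → Subset n
  Φ [ X ] = tabulate (λ y → lookup X (Φ ⟨$⟩ˡ y))

  -- D ∈ 𝒟 : D is a G*-orbit
  IsOrbit : Subset n → Set
  IsOrbit D = ∃ λ d → ∀ y → (y ∈ D → ∃ λ Φ → G Φ × Φ ⟨$⟩ʳ d ≡ y)
                          × ((∃ λ Φ → G Φ × Φ ⟨$⟩ʳ d ≡ y) → y ∈ D)

  -- B is a block of Λ*(D)  (σ = Φ|_D, and Φ|_D[B] = Φ[B] since B ⊆ D)
  IsBlock : Subset n → Subset n → Set
  IsBlock D B = B ⊆ D × (∀ Φ → G Φ → (Φ [ B ] ≡ B) ⊎ Empty (Φ [ B ] ∩ B))

  InOrbitOf : Subset n → Subset n → Set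
  InOrbitOf B X = ∃ λ Φ → G Φ × Φ [ B ] ≡ X

  SameInducedPerm : Subset n → Permutation′ n → Permutation′ n → Set
  SameInducedPerm B Φ Ψ = ∀ X → InOrbitOf B X → Φ [ X ] ≡ Ψ [ X ]

  InSub : Subset n → Subset n → Subset n → Set
  InSub S B X = InOrbitOf S X × X ⊆ B

  Stab : Subset n → Permutation′ n → Set
  Stab B Φ = G Φ × Φ [ B ] ⊆ B

  -- a (nonempty) block 𝔅 ⊆ B[Λ*(D)·S] of the induced group
  -- {Φ^{Λ*(D)·S}|_{B[Λ*(D)·S]} : Φ ∈ G*, Φ[B] ⊆ B}
  IsInducedBlock : Subset n → Subset n → (Subset n → Set) → Set
  IsInducedBlock S B 𝔅 =
    (∀ X → 𝔅 X → InSub S B X) ×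
    (∀ Φ → Stab B Φ →
       ((∀ X → 𝔅 X → 𝔅 (Φ [ X ])) × (∀ Y → 𝔅 Y → ∃ λ X → 𝔅 X × Φ [ X ] ≡ Y))
       ⊎ ¬ (∃ λ X → 𝔅 X × 𝔅 (Φ [ X ])))

  IsSingleton : (Subset n → Set) → Set
  IsSingleton 𝔅 = ∃ λ X → 𝔅 X × (∀ Y → 𝔅 Y → Y ≡ X)

  IsPrimitiveInduced : Subset n → Subset n → Set₁
  IsPrimitiveInduced S B =
    (∀ X Y → InSub S B X → InSub S B Y → ∃ λ Φ → Stab B Φ × Φ [ X ] ≡ Y) ×
    (∀ 𝔅 → IsInducedBlock S B 𝔅 → (∃ λ X → 𝔅 X) →
       IsSingleton 𝔅 ⊎ (∀ X → InSub S B X → 𝔅 X))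

  IsPrimitivePair : Subset n → Subset n → Subset n → Set₁
  IsPrimitivePair D S B =
    IsBlock D S × IsBlock D B × S ⊂ B × IsPrimitiveInduced S B

  Made : Subset n → Subset n → Set
  Made X Y = (∀ {x y} → x ∈ X → y ∈ Y → x < y)
           ⊎ (∀ {x y} → x ∈ X → y ∈ Y → y < x)

  Incomparable : Subset n → Subset n → Set
  Incomparable X Y = ∀ {x y} → x ∈ X → y ∈ Y → ¬ (x < y) × ¬ (y < x)

  NontriviallyWoven : Subset n → Subset n → Set
  NontriviallyWoven X Y = ¬ Made X Y × ¬ Incomparable X Y

  SameWeavingType : Subset n → Subset n → Subset n → Set
  SameWeavingType C S₁ S₂ =
    (Made C S₁ × Made C S₂)
    ⊎ (¬ Made C S₁ × ¬ Made C S₂ × Incomparable C S₁ × Incomparable C S₂)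
    ⊎ (NontriviallyWoven C S₁ × NontriviallyWoven C S₂ ×
       (∃ λ Φ → G Φ × Φ [ C ] ≡ C × Φ [ S₁ ] ≡ S₂))

{-# OPTIONS --safe #-}
-- Let K be the set of Θ ∈ G* acting trivially on Λ*(E)·C and on Λ*(D)·B; it
-- is a normal subgroup of G*, so its orbits on B[Λ*(D)·S] form a block system
-- of the primitive induced group.  If the K-orbit of S were all of
-- B[Λ*(D)·S], then, since K fixes C, all S' would have the same weaving type
-- with respect to C.  Hence K fixes S, and by normality every translate of S;
-- this applies to Θ = Φ Ψ⁻¹.  The argument is classical, but the conclusion
-- "κ[S] = S" is decidable, so it runs inside the double-negation monad.
module Submission where

open import Defs
open import Level using (0ℓ)
open import Data.Nat.Base using (ℕ; zero; suc)
open import Data.Fin.Base using (Fin)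
open import Data.Fin.Subset using (Subset; _∈_; _⊆_; inside; outside)
open import Data.Fin.Subset.Properties using (anySubset?)
open import Data.Fin.Permutation
  using (Permutation′; _⟨$⟩ʳ_; _⟨$⟩ˡ_; id; flip; _∘ₚ_; inverseʳ; inverseˡ)
open import Data.Vec.Base using ([]; _∷_; lookup; tabulate)
open import Data.Vec.Properties
  using (lookup∘tabulate; tabulate∘lookup; tabulate-cong; []=⇒lookup; lookup⇒[]=; ≡-dec)
open import Data.Bool.Properties using (_≟_)
open import Data.Product.Base using (∃; _×_; _,_; proj₁; proj₂)
open import Data.Sum.Base using (_⊎_; inj₁; inj₂; [_,_]′)
open import Function.Base using (_∘_)
open import Function.Bundles using (_⇔_; mk⇔; Equivalence)
open import Relation.Nullary using (¬_; Dec; yes; no; _×-dec_)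
open import Relation.Nullary.Decidable using (decidable-stable; ¬¬-excluded-middle)
import Relation.Nullary.Decidable as Dec
open import Relation.Nullary.Negation using (¬¬-map)
open import Relation.Unary using (Pred; Decidable)
open import Relation.Binary.Core using (Rel)
open import Relation.Binary.PropositionalEquality hiding ([_])

¬¬-decidable : ∀ {n} (P : Pred (Subset n) 0ℓ) → ¬ ¬ Decidable P
¬¬-decidable {zero} P = ¬¬-map (λ P[]? → λ { [] → P[]? }) ¬¬-excluded-middle
¬¬-decidable {suc n} P k =
  ¬¬-decidable (P ∘ (inside ∷_)) λ P-inside? →
  ¬¬-decidable (P ∘ (outside ∷_)) λ P-outside? →
  k λ { (inside ∷ X) → P-inside? X ; (outside ∷ X) → P-outside? X }

module _ {n : ℕ} (_<_ : Rel (Fin n) 0ℓ) (G : Pred (Permutation′ n) 0ℓ) where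
  open Config _<_ G
  open Equivalence using (to; from)

  private
    variable
      Φ Ψ θ : Permutation′ n
      C O X Y : Subset n

  image-image : ∀ Φ Ψ X → Φ [ Ψ [ X ] ] ≡ tabulate (λ y → lookup X (Ψ ⟨$⟩ˡ (Φ ⟨$⟩ˡ y)))
  image-image Φ Ψ X = tabulate-cong (λ y → lookup∘tabulate _ (Φ ⟨$⟩ˡ y))

  image-∘ₚ : ∀ Φ Ψ X → (Φ ∘ₚ Ψ) [ X ] ≡ Ψ [ Φ [ X ] ]
  image-∘ₚ Φ Ψ X = sym (image-image Ψ Φ X)

  image-conjugate : ∀ Φ κ X → (flip Φ ∘ₚ κ ∘ₚ Φ) [ X ] ≡ Φ [ κ [ flip Φ [ X ] ] ]
  image-conjugate Φ κ X = trans (image-∘ₚ (flip Φ) (κ ∘ₚ Φ) X) (image-∘ₚ κ Φ (flip Φ [ X ]))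

  image-id : ∀ X → id [ X ] ≡ X
  image-id X = tabulate∘lookup X

  image-flip-image : ∀ Φ X → flip Φ [ Φ [ X ] ] ≡ X
  image-flip-image Φ X = begin
    flip Φ [ Φ [ X ] ]                             ≡⟨ image-image (flip Φ) Φ X ⟩
    tabulate (λ y → lookup X (Φ ⟨$⟩ˡ (Φ ⟨$⟩ʳ y)))  ≡⟨ tabulate-cong (λ _ → cong (lookup X) (inverseˡ Φ)) ⟩
    tabulate (lookup X)                            ≡⟨ tabulate∘lookup X ⟩
    X                                              ∎
    where open ≡-Reasoning

  image-image-flip : ∀ Φ X → Φ [ flip Φ [ X ] ] ≡ X
  image-image-flip Φ X = image-flip-image (flip Φ) X

  ∈-image⁻ : ∀ {x} → x ∈ Φ [ X ] → Φ ⟨$⟩ˡ x ∈ X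
  ∈-image⁻ {Φ} {X} {x} x∈ΦX =
    lookup⇒[]= _ X (trans (sym (lookup∘tabulate _ x)) ([]=⇒lookup x∈ΦX))

  ∈-image⁺ : ∀ {x} → x ∈ X → Φ ⟨$⟩ʳ x ∈ Φ [ X ]
  ∈-image⁺ {X} {Φ} {x} x∈X = lookup⇒[]= _ (Φ [ X ]) (begin
    lookup (Φ [ X ]) (Φ ⟨$⟩ʳ x)   ≡⟨ lookup∘tabulate _ (Φ ⟨$⟩ʳ x) ⟩
    lookup X (Φ ⟨$⟩ˡ (Φ ⟨$⟩ʳ x))  ≡⟨ cong (lookup X) (inverseˡ Φ) ⟩
    lookup X x                    ≡⟨ []=⇒lookup x∈X ⟩
    inside                        ∎)
    where open ≡-Reasoning

  automorphism-flip : IsAutomorphism Φ → IsAutomorphism (flip Φ)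
  automorphism-flip {Φ} aut x y =
    (λ x<y → proj₂ (aut (Φ ⟨$⟩ˡ x) (Φ ⟨$⟩ˡ y)) (subst₂ _<_ (sym (inverseʳ Φ)) (sym (inverseʳ Φ)) x<y)) ,
    (λ Φx<Φy → subst₂ _<_ (inverseʳ Φ) (inverseʳ Φ) (proj₁ (aut (Φ ⟨$⟩ˡ x) (Φ ⟨$⟩ˡ y)) Φx<Φy))

  made-image : IsAutomorphism Φ → Made X Y → Made (Φ [ X ]) (Φ [ Y ])
  made-image {Φ} {X} {Y} aut (inj₁ X<Y) = inj₁ λ x∈ y∈ →
    proj₂ (automorphism-flip {Φ} aut _ _) (X<Y (∈-image⁻ {Φ} {X} x∈) (∈-image⁻ {Φ} {Y} y∈))
  made-image {Φ} {X} {Y} aut (inj₂ Y<X) = inj₂ λ x∈ y∈ →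
    proj₂ (automorphism-flip {Φ} aut _ _) (Y<X (∈-image⁻ {Φ} {X} x∈) (∈-image⁻ {Φ} {Y} y∈))

  incomparable-image : IsAutomorphism Φ → Incomparable X Y → Incomparable (Φ [ X ]) (Φ [ Y ])
  incomparable-image {Φ} {X} {Y} aut X∥Y x∈ y∈ =
    let x∦y = X∥Y (∈-image⁻ {Φ} {X} x∈) (∈-image⁻ {Φ} {Y} y∈)
    in proj₁ x∦y ∘ proj₁ (automorphism-flip {Φ} aut _ _) ,
       proj₂ x∦y ∘ proj₁ (automorphism-flip {Φ} aut _ _)

  made-stabilised : ∀ θ C X → IsAutomorphism θ → θ [ C ] ≡ C → θ [ X ] ≡ Y → Made C X ⇔ Made C Y
  made-stabilised {Y} θ C X aut θC≡C θX≡Y = mk⇔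
    (subst₂ Made θC≡C θX≡Y ∘ made-image {θ} {C} {X} aut)
    (λ m → subst₂ Made (image-flip-image θ C) (image-flip-image θ X)
             (made-image {flip θ} (automorphism-flip {θ} aut) (subst₂ Made (sym θC≡C) (sym θX≡Y) m)))

  incomparable-stabilised : ∀ θ C X → IsAutomorphism θ → θ [ C ] ≡ C → θ [ X ] ≡ Y →
                            Incomparable C X ⇔ Incomparable C Y
  incomparable-stabilised {Y} θ C X aut θC≡C θX≡Y = mk⇔
    (subst₂ Incomparable θC≡C θX≡Y ∘ incomparable-image {θ} {C} {X} aut)
    (λ i → subst₂ Incomparable (image-flip-image θ C) (image-flip-image θ X)
             (incomparable-image {flip θ} (automorphism-flip {θ} aut)
               (subst₂ Incomparable (sym θC≡C) (sym θX≡Y) i)))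

  sameWeavingType-stabilised : ∀ θ C X → G θ → IsAutomorphism θ → θ [ C ] ≡ C → θ [ X ] ≡ Y →
                               Dec (Made C X) → Dec (Incomparable C X) → SameWeavingType C X Y
  sameWeavingType-stabilised {Y} θ C X Gθ aut θC≡C θX≡Y = classify
    where
    made : Made C X ⇔ Made C Y
    made = made-stabilised θ C X aut θC≡C θX≡Y
    incomparable : Incomparable C X ⇔ Incomparable C Y
    incomparable = incomparable-stabilised θ C X aut θC≡C θX≡Y
    classify : Dec (Made C X) → Dec (Incomparable C X) → SameWeavingType C X Y
    classify (yes m)  _       = inj₁ (m , to made m)
    classify (no ¬m)  (yes i) = inj₂ (inj₁ (¬m , ¬m ∘ from made , i , to incomparable i))
    classify (no ¬m)  (no ¬i) =
      inj₂ (inj₂ ((¬m , ¬i) , (¬m ∘ from made , ¬i ∘ from incomparable) , θ , Gθ , θC≡C , θX≡Y))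

  record Fixes (O : Subset n) (κ : Permutation′ n) : Set where
    field
      fixed : ∀ X → InOrbitOf O X → κ [ X ] ≡ X
  open Fixes

  sameInducedPerm⇒fixes : SameInducedPerm O Φ Ψ → Fixes O (Φ ∘ₚ flip Ψ)
  sameInducedPerm⇒fixes {O} {Φ} {Ψ} same .fixed X X∈O = begin
    (Φ ∘ₚ flip Ψ) [ X ]  ≡⟨ image-∘ₚ Φ (flip Ψ) X ⟩
    flip Ψ [ Φ [ X ] ]   ≡⟨ cong (flip Ψ [_]) (same X X∈O) ⟩
    flip Ψ [ Ψ [ X ] ]   ≡⟨ image-flip-image Ψ X ⟩
    X                    ∎
    where open ≡-Reasoning

  fixes⇒sameInducedPerm : Fixes O (Φ ∘ₚ flip Ψ) → SameInducedPerm O Φ Ψ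
  fixes⇒sameInducedPerm {O} {Φ} {Ψ} fix X X∈O = begin
    Φ [ X ]                   ≡⟨ image-image-flip Ψ (Φ [ X ]) ⟨
    Ψ [ flip Ψ [ Φ [ X ] ] ]  ≡⟨ cong (Ψ [_]) (trans (sym (image-∘ₚ Φ (flip Ψ) X)) (fixed fix X X∈O)) ⟩
    Ψ [ X ]                   ∎
    where open ≡-Reasoning

  module _ (isSubgroup : IsSubgroupOfAut) where
    open IsSubgroupOfAut isSubgroup

    inOrbitOf-image : ∀ O → G Φ → InOrbitOf O X → InOrbitOf O (Φ [ X ])
    inOrbitOf-image {Φ} O GΦ (α , Gα , αO≡X) =
      α ∘ₚ Φ , ∘∈ Gα GΦ , trans (image-∘ₚ α Φ O) (cong (Φ [_]) αO≡X)

    fixes-id : Fixes O id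
    fixes-id .fixed X _ = image-id X

    fixes-∘ₚ : ∀ {κ κ′} → Fixes O κ → Fixes O κ′ → Fixes O (κ ∘ₚ κ′)
    fixes-∘ₚ {κ = κ} {κ′} fix fix′ .fixed X X∈O =
      trans (image-∘ₚ κ κ′ X) (trans (cong (κ′ [_]) (fixed fix X X∈O)) (fixed fix′ X X∈O))

    fixes-flip : ∀ {κ} → Fixes O κ → Fixes O (flip κ)
    fixes-flip {κ = κ} fix .fixed X X∈O =
      trans (cong (flip κ [_]) (sym (fixed fix X X∈O))) (image-flip-image κ X)

    fixes-conjugate : ∀ {κ} → G Φ → Fixes O κ → Fixes O (flip Φ ∘ₚ κ ∘ₚ Φ)
    fixes-conjugate {Φ} {O} {κ} GΦ fix .fixed X X∈O = begin
      (flip Φ ∘ₚ κ ∘ₚ Φ) [ X ]    ≡⟨ image-conjugate Φ κ X ⟩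
      Φ [ κ [ flip Φ [ X ] ] ]    ≡⟨ cong (Φ [_]) (fixed fix _ (inOrbitOf-image O (inv∈ GΦ) X∈O)) ⟩
      Φ [ flip Φ [ X ] ]          ≡⟨ image-image-flip Φ X ⟩
      X                           ∎
      where open ≡-Reasoning

    record IsNormalSubgroup (K : Pred (Permutation′ n) 0ℓ) : Set where
      field
        ⊆G     : ∀ {κ} → K κ → G κ
        idK    : K id
        ∘K     : ∀ {κ κ′} → K κ → K κ′ → K (κ ∘ₚ κ′)
        flipK  : ∀ {κ} → K κ → K (flip κ)
        conjK  : ∀ {κ} → G Φ → K κ → K (flip Φ ∘ₚ κ ∘ₚ Φ)

    record Kernel (C B : Subset n) (κ : Permutation′ n) : Set where
      field
        inG    : G κ
        fixesC : Fixes C κ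
        fixesB : Fixes B κ
    open Kernel

    kernel-isNormal : ∀ C B → IsNormalSubgroup (Kernel C B)
    kernel-isNormal C B = record
      { ⊆G    = inG
      ; idK   = record { inG = id∈ ; fixesC = fixes-id ; fixesB = fixes-id }
      ; ∘K    = λ k k′ → record
                  { inG = ∘∈ (inG k) (inG k′)
                  ; fixesC = fixes-∘ₚ (fixesC k) (fixesC k′)
                  ; fixesB = fixes-∘ₚ (fixesB k) (fixesB k′) }
      ; flipK = λ k → record
                  { inG = inv∈ (inG k)
                  ; fixesC = fixes-flip (fixesC k)
                  ; fixesB = fixes-flip (fixesB k) }
      ; conjK = λ GΦ k → record
                  { inG = ∘∈ (inv∈ GΦ) (∘∈ (inG k) GΦ)
                  ; fixesC = fixes-conjugate GΦ (fixesC k)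
                  ; fixesB = fixes-conjugate GΦ (fixesB k) }
      }

    fixes-self : Fixes O θ → θ [ O ] ≡ O
    fixes-self {O} fix = fixed fix O (id , id∈ , image-id O)

    module Orbits {K : Pred (Permutation′ n) 0ℓ} (normal : IsNormalSubgroup K) where
      open IsNormalSubgroup normal

      infix 4 _~_
      data _~_ (X Y : Subset n) : Set where
        translate : ∀ κ → K κ → κ [ X ] ≡ Y → X ~ Y

      ~-refl : X ~ X
      ~-refl {X} = translate id idK (image-id X)

      ~-sym : X ~ Y → Y ~ X
      ~-sym {X} (translate κ Kκ κX≡Y) =
        translate (flip κ) (flipK Kκ) (trans (cong (flip κ [_]) (sym κX≡Y)) (image-flip-image κ X))

      ~-trans : ∀ {Z} → X ~ Y → Y ~ Z → X ~ Z
      ~-trans {X} (translate κ Kκ κX≡Y) (translate κ′ Kκ′ κ′Y≡Z) =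
        translate (κ ∘ₚ κ′) (∘K Kκ Kκ′) (trans (image-∘ₚ κ κ′ X) (trans (cong (κ′ [_]) κX≡Y) κ′Y≡Z))

      ~-image : G Φ → X ~ Y → Φ [ X ] ~ Φ [ Y ]
      ~-image {Φ} {X} {Y} GΦ (translate κ Kκ κX≡Y) = translate (flip Φ ∘ₚ κ ∘ₚ Φ) (conjK GΦ Kκ) (begin
        (flip Φ ∘ₚ κ ∘ₚ Φ) [ Φ [ X ] ]    ≡⟨ image-conjugate Φ κ (Φ [ X ]) ⟩
        Φ [ κ [ flip Φ [ Φ [ X ] ] ] ]    ≡⟨ cong (λ Z → Φ [ κ [ Z ] ]) (image-flip-image Φ X) ⟩
        Φ [ κ [ X ] ]                     ≡⟨ cong (Φ [_]) κX≡Y ⟩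
        Φ [ Y ]                           ∎)
        where open ≡-Reasoning

      fixes-translates : ∀ {S} → (∀ {κ} → K κ → κ [ S ] ≡ S) → ∀ {κ} → K κ → Fixes S κ
      fixes-translates {S} fixS {κ} Kκ .fixed X (α , Gα , αS≡X) = begin
        κ [ X ]                             ≡⟨ cong (κ [_]) αS≡X ⟨
        κ [ α [ S ] ]                       ≡⟨ image-image-flip α _ ⟨
        α [ flip α [ κ [ α [ S ] ] ] ]      ≡⟨ cong (α [_]) (image-conjugate (flip α) κ S) ⟨
        α [ (α ∘ₚ κ ∘ₚ flip α) [ S ] ]      ≡⟨ cong (α [_]) (fixS (conjK (inv∈ Gα) Kκ)) ⟩
        α [ S ]                             ≡⟨ αS≡X ⟩
        X                                   ∎
        where open ≡-Reasoning

      module _ {S B : Subset n} (S⊆B : S ⊆ B) (fixB : ∀ {κ} → K κ → κ [ B ] ≡ B) where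

        orbit-⊆-InSub : ∀ X → S ~ X → InSub S B X
        orbit-⊆-InSub X (translate κ Kκ κS≡X) = (κ , ⊆G Kκ , κS≡X) , λ {x} x∈X →
          subst (x ∈_) (fixB Kκ) (subst (_∈ κ [ B ]) (inverseʳ κ)
            (∈-image⁺ {Φ = κ} (S⊆B (∈-image⁻ {κ} (subst (x ∈_) (sym κS≡X) x∈X)))))

        orbit-isInducedBlock : Decidable (S ~_) → IsInducedBlock S B (S ~_)
        orbit-isInducedBlock S~? = orbit-⊆-InSub , λ Φ (GΦ , _) →
          meets-or-misses GΦ (anySubset? λ X → S~? X ×-dec S~? (Φ [ X ]))
          where
          meets-or-misses : G Φ → Dec (∃ λ X → S ~ X × S ~ Φ [ X ]) →
            ((∀ X → S ~ X → S ~ Φ [ X ]) × (∀ Y → S ~ Y → ∃ λ X → S ~ X × Φ [ X ] ≡ Y))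
            ⊎ ¬ (∃ λ X → S ~ X × S ~ Φ [ X ])
          meets-or-misses _   (no misses)            = inj₂ misses
          meets-or-misses {Φ} GΦ (yes (X , S~X , S~ΦX)) =
            inj₁ ( (λ Y S~Y → ~-trans S~ΦX (~-image GΦ (~-trans (~-sym S~X) S~Y)))
                 , (λ Y S~Y → flip Φ [ Y ]
                            , ~-trans S~X (subst (_~ flip Φ [ Y ]) (image-flip-image Φ X)
                                (~-image (inv∈ GΦ) (~-trans (~-sym S~ΦX) S~Y)))
                            , image-image-flip Φ Y))

      orbit-sameWeavingType : ∀ {C S} → (∀ {κ} → K κ → κ [ C ] ≡ C) →
        Dec (Made C S) → Dec (Incomparable C S) →
        ∀ {S₁ S₂} → S ~ S₁ → S ~ S₂ → SameWeavingType C S₁ S₂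
      orbit-sameWeavingType {C} {S} fixC made? incomparable? S~S₁@(translate κ₁ Kκ₁ κ₁S≡S₁) S~S₂
        with ~-trans (~-sym S~S₁) S~S₂
      ... | translate θ Kθ θS₁≡S₂ =
        let autκ₁ = ⊆Aut (⊆G Kκ₁)
        in sameWeavingType-stabilised θ C _ (⊆G Kθ) (⊆Aut (⊆G Kθ)) (fixC Kθ) θS₁≡S₂
             (Dec.map (made-stabilised κ₁ C S autκ₁ (fixC Kκ₁) κ₁S≡S₁) made?)
             (Dec.map (incomparable-stabilised κ₁ C S autκ₁ (fixC Kκ₁) κ₁S≡S₁) incomparable?)

    kernel-fixes : ∀ {S B C} → IsPrimitiveInduced S B → S ⊆ B →
      ¬ (∀ S₁ S₂ → InSub S B S₁ → InSub S B S₂ → SameWeavingType C S₁ S₂) →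
      ∀ {κ} → Kernel C B κ → κ [ S ] ≡ S
    kernel-fixes {S} {B} {C} (_ , isPrimitive) S⊆B differentTypes {κ} Kκ =
      decidable-stable (≡-dec _≟_ (κ [ S ]) S) λ κS≢S →
      ¬¬-decidable (S ~_) λ S~? →
      ¬¬-excluded-middle λ made? →
      ¬¬-excluded-middle λ incomparable? →
      [ (λ (_ , _ , singleton) →
           κS≢S (trans (singleton _ (translate κ Kκ refl)) (sym (singleton S ~-refl))))
      , (λ everything → differentTypes λ S₁ S₂ S₁∈ S₂∈ →
           orbit-sameWeavingType (fixes-self ∘ fixesC) made? incomparable?
             (everything S₁ S₁∈) (everything S₂ S₂∈))
      ]′ (isPrimitive (S ~_) (orbit-isInducedBlock S⊆B (fixes-self ∘ fixesB) S~?) (S , ~-refl))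
      where open Orbits (kernel-isNormal C B)

lemma5p10 : (n : ℕ) (_<_ : Rel (Fin n) 0ℓ) (G : Pred (Permutation′ n) 0ℓ) →
    let open Config _<_ G in
    IsStandardConfiguration →
    (D E : Subset n) → IsOrbit D → IsOrbit E →
    (S B : Subset n) → IsPrimitivePair D S B →
    (C : Subset n) → IsBlock E C →
    ¬ (∀ S₁ S₂ → InSub S B S₁ → InSub S B S₂ → SameWeavingType C S₁ S₂) →
    (Φ Ψ : Permutation′ n) → G Φ → G Ψ →
    SameInducedPerm C Φ Ψ → SameInducedPerm B Φ Ψ →
    SameInducedPerm S Φ Ψ
lemma5p10 _ _<_ G standard _ _ _ _ S B (_ , _ , (S⊆B , _) , isPrimitive) C _ differentTypes
          Φ Ψ GΦ GΨ sameC sameB =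
  fixes⇒sameInducedPerm _<_ G {S} {Φ} {Ψ}
    (fixes-translates (kernel-fixes _<_ G isSubgroup isPrimitive S⊆B differentTypes) ΦΨ⁻¹∈K)
  where
  open Config _<_ G using (module IsStandardConfiguration; module IsSubgroupOfAut)
  open IsStandardConfiguration standard using (isSubgroup)
  open IsSubgroupOfAut isSubgroup using (∘∈; inv∈)
  open Orbits _<_ G isSubgroup (kernel-isNormal _<_ G isSubgroup C B) using (fixes-translates)
  ΦΨ⁻¹∈K : Kernel _<_ G isSubgroup C B (Φ ∘ₚ flip Ψ)
  ΦΨ⁻¹∈K = record
    { inG = ∘∈ GΦ (inv∈ GΨ)
    ; fixesC = sameInducedPerm⇒fixes _<_ G {C} {Φ} {Ψ} sameC
    ; fixesB = sameInducedPerm⇒fixes _<_ G {B} {Φ} {Ψ} sameB }
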